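{- Let $S,P,Q$ be pairwise disjoint finite sets, $\mathcal M_{SP},\mathcal M_{PQ}$ matroids on $S\uplus P$, $P\uplus Q$, and $\mathcal M_{SQ}:=\mathcal M_{SP}\leftrightarrow\mathcal M_{PQ}$. Then $$|P|\geq r(\mathcal M_{SQ}\circ S)-r(\mathcal M_{SQ}\times S)=r(\mathcal M_{SQ}\circ Q)-r(\mathcal M_{SQ}\times Q).$$
   Context: For a matroid $\mathcal M$ on $X$ and $T\subseteq X$: $\mathcal M\circ T$ is the restriction to $T$ (delete $X-T$), $\mathcal M\times T$ the contraction to $T$ (contract $X-T$); $r(\cdot)$ is the rank. $\mathbf 0_X$ is the matroid on $X$ whose only base is $\emptyset$. For matroids on the same set, $\mathcal M_1\vee\mathcal M_2$ has as bases the maximal sets $b_1\cup b_2$ with $b_i$ a base of $\mathcal M_i$. The linking is $\mathcal M_{SP}\leftrightarrow\mathcal M_{PQ}:=((\mathcal M_{SP}\oplus\mathbf 0_Q)\vee(\mathcal M_{PQ}\oplus\mathbf 0_S))\times(S\uplus Q)$. -}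

module Defs where

open import Data.Nat using (ℕ; zero; suc; _<_; _⊔_; _≡ᵇ_)
open import Data.Bool using (Bool; true; false; _∧_; _∨_; not; T)
open import Data.List using (List; []; _∷_; _++_; map; filter; foldr; concatMap)
open import Data.Bool.ListAction using (any)
open import Data.Vec using (Vec; []; _∷_)
open import Data.Fin using (Fin)
open import Data.Fin.Subset using (Subset; _⊆_; _∈_; _∉_; _∪_; _∩_; _─_; ⊥; ∣_∣; ⁅_⁆)
open import Data.Product using (∃; _×_)

subsets : (n : ℕ) → List (Subset n)
subsets zero = [] ∷ []
subsets (suc n) = concatMap (λ s → (false ∷ s) ∷ (true ∷ s) ∷ []) (subsets n)

_⊆ᵇ_ : ∀ {n} → Subset n → Subset n → Bool
[] ⊆ᵇ [] = true
(x ∷ xs) ⊆ᵇ (y ∷ ys) = (not x ∨ y) ∧ (xs ⊆ᵇ ys)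

maximum : List ℕ → ℕ
maximum = foldr _⊔_ 0

-- A (candidate) matroid on the ground set `ground` ⊆ Fin n, given by its
-- family of independent sets (as a Boolean predicate on subsets of Fin n).
record SetSystem (n : ℕ) : Set where
  constructor mkSS
  field
    ground : Subset n
    indep  : Subset n → Bool
open SetSystem public

record IsMatroid {n : ℕ} (M : SetSystem n) : Set where
  field
    indep⊆ground : ∀ I → T (indep M I) → I ⊆ ground M
    indep-∅      : T (indep M ⊥)
    hereditary   : ∀ I J → J ⊆ I → T (indep M I) → T (indep M J)
    augment      : ∀ I J → T (indep M I) → T (indep M J) → ∣ I ∣ < ∣ J ∣ →
                   ∃ λ x → x ∈ J × x ∉ I × T (indep M (I ∪ ⁅ x ⁆))

record Matroid (n : ℕ) : Set where
  field
    sys       : SetSystem n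
    isMatroid : IsMatroid sys
open Matroid public

rankOf : ∀ {n} → SetSystem n → Subset n → ℕ
rankOf {n} M A = maximum (map ∣_∣ (filter (λ I → T? (indep M I ∧ (I ⊆ᵇ A))) (subsets n)))
  where
  open import Relation.Nullary.Decidable using (Dec)
  open import Data.Bool.Properties using (T?)

r : ∀ {n} → SetSystem n → ℕ
r M = rankOf M (ground M)

isBase : ∀ {n} → SetSystem n → Subset n → Bool
isBase M b = indep M b ∧ (∣ b ∣ ≡ᵇ r M)

_∘ᴹ_ : ∀ {n} → SetSystem n → Subset n → SetSystem n
M ∘ᴹ A = mkSS A (λ I → indep M I ∧ (I ⊆ᵇ A))

-- contraction M × T  (contract Z = ground − T):
-- I ⊆ T is independent iff r(I ∪ Z) = |I| + r(Z)
_×ᴹ_ : ∀ {n} → SetSystem n → Subset n → SetSystem n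
M ×ᴹ A = mkSS A (λ I → (I ⊆ᵇ A) ∧ (rankOf M (I ∪ Z) ≡ᵇ (∣ I ∣ Data.Nat.+ rankOf M Z)))
  where Z = ground M ─ A

_⊕𝟎_ : ∀ {n} → SetSystem n → Subset n → SetSystem n
M ⊕𝟎 Q = mkSS (ground M ∪ Q) (indep M)

-- matroid union M₁ ∨ M₂ on the common ground set: the bases are the maximal
-- sets b₁ ∪ b₂ (bᵢ a base of Mᵢ); independent sets are the subsets of bases,
-- i.e. the subsets of some b₁ ∪ b₂.
_∨ᴹ_ : ∀ {n} → SetSystem n → SetSystem n → SetSystem n
_∨ᴹ_ {n} M₁ M₂ = mkSS (ground M₁)
  (λ I → any (λ b₁ → isBase M₁ b₁ ∧ any (λ b₂ → isBase M₂ b₂ ∧ (I ⊆ᵇ (b₁ ∪ b₂))) (subsets n)) (subsets n))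

link : ∀ {n} → (S Q : Subset n) → SetSystem n → SetSystem n → SetSystem n
link S Q Msp Mpq = ((Msp ⊕𝟎 Q) ∨ᴹ (Mpq ⊕𝟎 S)) ×ᴹ (S ∪ Q)

-- U = (M_SP ⊕ 𝟎_Q) ∨ (M_PQ ⊕ 𝟎_S) is a matroid: the matroid union theorem, proved by the usual
-- exchange argument on splittings of independent sets into an M₁- and an M₂-independent part.
-- M_SQ = U × (S ∪ Q) is the contraction of U by Z = P, so its rank is r_SQ(A) = ρ(A ∪ Z) - ρ(Z)
-- for the rank ρ of U. Hence r(M_SQ × S) = r(M_SQ) - r_SQ(Q), and both differences in the statement
-- equal the connectivity r_SQ(S) + r_SQ(Q) - r(M_SQ), which is symmetric in S and Q. It is at most
-- |P| because ρ(S ∪ Z) ≤ |Z| + ρ(S) and ρ(S) + ρ(Q ∪ Z) ≤ ρ(S ∪ Q ∪ Z) + ρ(Z): a basis of S is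
-- M_SP-independent, so it absorbs the M_PQ-part of a basis of Q ∪ Z, and the rest of that basis lies in Z.

module Submission where

open import Defs
open import Data.Fin.Subset using (Subset; _∩_; _∪_; ⊥; ∣_∣)
open import Relation.Binary.PropositionalEquality using (_≡_; sym; trans; subst)

module SubsetFacts where

  open import Data.Nat using (suc; _+_)
  open import Data.Nat.Properties using (+-suc; +-comm)
  open import Data.Bool using (true; false)
  open import Data.Vec.Base using ([]; _∷_; here; there)
  open import Data.Fin using (Fin; zero)
  open import Data.Fin.Subset using (_∈_; _∉_; _⊆_; _─_; ⁅_⁆)
  open import Data.Fin.Subset.Properties
    using (_∈?_; ∉⊥; x∈p∧x∉q⇒x∈p─q; x∈p∩q⁺; x∈p∪q⁺; x∈p∪q⁻; ⊆-antisym; ∣⁅x⁆∣≡1; x∈⁅y⁆⇒x≡y)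
  open import Data.Product using (_×_; _,_; proj₁)
  open import Data.Sum using (inj₁; inj₂; [_,_])
  open import Data.Empty using (⊥-elim)
  open import Relation.Nullary using (yes; no)
  open import Relation.Binary.PropositionalEquality using (refl; cong; module ≡-Reasoning)

  Disjoint : ∀ {n} → Subset n → Subset n → Set
  Disjoint p q = ∀ {x} → x ∈ p → x ∉ q

  ∩≡⊥⇒Disjoint : ∀ {n} {p q : Subset n} → p ∩ q ≡ ⊥ → Disjoint p q
  ∩≡⊥⇒Disjoint p∩q≡⊥ x∈p x∈q = ∉⊥ (subst (_ ∈_) p∩q≡⊥ (x∈p∩q⁺ (x∈p , x∈q)))

  ∪-⊆ : ∀ {n} {p q r : Subset n} → p ⊆ r → q ⊆ r → p ∪ q ⊆ r
  ∪-⊆ {p = p} {q} p⊆r q⊆r x∈p∪q = [ p⊆r , q⊆r ] (x∈p∪q⁻ p q x∈p∪q)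

  ∪-mono-⊆ : ∀ {n} {p p′ q q′ : Subset n} → p ⊆ p′ → q ⊆ q′ → p ∪ q ⊆ p′ ∪ q′
  ∪-mono-⊆ {p = p} {q = q} p⊆p′ q⊆q′ x∈p∪q =
    x∈p∪q⁺ ([ (λ x∈p → inj₁ (p⊆p′ x∈p)) , (λ x∈q → inj₂ (q⊆q′ x∈q)) ] (x∈p∪q⁻ p q x∈p∪q))

  ⁅x⁆⊆p : ∀ {n} {x : Fin n} {p : Subset n} → x ∈ p → ⁅ x ⁆ ⊆ p
  ⁅x⁆⊆p {x = x} {p} x∈p y∈⁅x⁆ = subst (_∈ p) (sym (x∈⁅y⁆⇒x≡y x y∈⁅x⁆)) x∈p

  x∈p─q⁻ : ∀ {n} {x : Fin n} (p q : Subset n) → x ∈ p ─ q → x ∈ p × x ∉ q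
  x∈p─q⁻ (true ∷ p) (false ∷ q) here = here , λ ()
  x∈p─q⁻ {x = zero} (true ∷ p) (true ∷ q) ()
  x∈p─q⁻ {x = zero} (false ∷ p) (true ∷ q) ()
  x∈p─q⁻ {x = zero} (false ∷ p) (false ∷ q) ()
  x∈p─q⁻ (s ∷ p) (t ∷ q) (there x∈p─q) with x∈p─q⁻ p q x∈p─q
  ... | x∈p , x∉q = there x∈p , λ { (there x∈q) → x∉q x∈q }

  p⊆q∪r⇒p─r⊆q : ∀ {n} {p q r : Subset n} → p ⊆ q ∪ r → p ─ r ⊆ q
  p⊆q∪r⇒p─r⊆q {p = p} {q} {r} p⊆q∪r x∈p─r with x∈p─q⁻ p r x∈p─r
  ... | x∈p , x∉r = [ (λ x∈q → x∈q) , (λ x∈r → ⊥-elim (x∉r x∈r)) ] (x∈p∪q⁻ q r (p⊆q∪r x∈p))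

  p⊆[p─q]∪q : ∀ {n} (p q : Subset n) → p ⊆ (p ─ q) ∪ q
  p⊆[p─q]∪q p q {x} x∈p with x ∈? q
  ... | yes x∈q = x∈p∪q⁺ (inj₂ x∈q)
  ... | no  x∉q = x∈p∪q⁺ (inj₁ (x∈p∧x∉q⇒x∈p─q x∈p x∉q))

  ∣p∣≡∣p∩q∣+∣p─q∣ : ∀ {n} (p q : Subset n) → ∣ p ∣ ≡ ∣ p ∩ q ∣ + ∣ p ─ q ∣
  ∣p∣≡∣p∩q∣+∣p─q∣ []          []          = refl
  ∣p∣≡∣p∩q∣+∣p─q∣ (true ∷ p)  (true ∷ q)  = cong suc (∣p∣≡∣p∩q∣+∣p─q∣ p q)
  ∣p∣≡∣p∩q∣+∣p─q∣ (true ∷ p)  (false ∷ q) = trans (cong suc (∣p∣≡∣p∩q∣+∣p─q∣ p q)) (sym (+-suc _ _))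
  ∣p∣≡∣p∩q∣+∣p─q∣ (false ∷ p) (true ∷ q)  = ∣p∣≡∣p∩q∣+∣p─q∣ p q
  ∣p∣≡∣p∩q∣+∣p─q∣ (false ∷ p) (false ∷ q) = ∣p∣≡∣p∩q∣+∣p─q∣ p q

  [p─q]∪[p∩q]≡p : ∀ {n} (p q : Subset n) → (p ─ q) ∪ (p ∩ q) ≡ p
  [p─q]∪[p∩q]≡p []          []          = refl
  [p─q]∪[p∩q]≡p (true ∷ p)  (true ∷ q)  = cong (true ∷_) ([p─q]∪[p∩q]≡p p q)
  [p─q]∪[p∩q]≡p (true ∷ p)  (false ∷ q) = cong (true ∷_) ([p─q]∪[p∩q]≡p p q)
  [p─q]∪[p∩q]≡p (false ∷ p) (true ∷ q)  = cong (false ∷_) ([p─q]∪[p∩q]≡p p q)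
  [p─q]∪[p∩q]≡p (false ∷ p) (false ∷ q) = cong (false ∷_) ([p─q]∪[p∩q]≡p p q)

  ∣p∪q∣≡∣p∣+∣q∣ : ∀ {n} (p q : Subset n) → Disjoint p q → ∣ p ∪ q ∣ ≡ ∣ p ∣ + ∣ q ∣
  ∣p∪q∣≡∣p∣+∣q∣ []          []          _ = refl
  ∣p∪q∣≡∣p∣+∣q∣ (true ∷ p)  (true ∷ q)  p#q = ⊥-elim (p#q here here)
  ∣p∪q∣≡∣p∣+∣q∣ (true ∷ p)  (false ∷ q) p#q = cong suc (∣p∪q∣≡∣p∣+∣q∣ p q (λ x∈p x∈q → p#q (there x∈p) (there x∈q)))
  ∣p∪q∣≡∣p∣+∣q∣ (false ∷ p) (true ∷ q)  p#q =
    trans (cong suc (∣p∪q∣≡∣p∣+∣q∣ p q (λ x∈p x∈q → p#q (there x∈p) (there x∈q)))) (sym (+-suc _ _))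
  ∣p∪q∣≡∣p∣+∣q∣ (false ∷ p) (false ∷ q) p#q = ∣p∪q∣≡∣p∣+∣q∣ p q (λ x∈p x∈q → p#q (there x∈p) (there x∈q))

  ∣p∪⁅x⁆∣≡1+∣p∣ : ∀ {n} {x : Fin n} (p : Subset n) → x ∉ p → ∣ p ∪ ⁅ x ⁆ ∣ ≡ suc ∣ p ∣
  ∣p∪⁅x⁆∣≡1+∣p∣ {x = x} p x∉p = begin
    ∣ p ∪ ⁅ x ⁆ ∣       ≡⟨ ∣p∪q∣≡∣p∣+∣q∣ p ⁅ x ⁆ (λ y∈p y∈⁅x⁆ → x∉p (subst (_∈ p) (x∈⁅y⁆⇒x≡y x y∈⁅x⁆) y∈p)) ⟩
    ∣ p ∣ + ∣ ⁅ x ⁆ ∣   ≡⟨ cong (∣ p ∣ +_) (∣⁅x⁆∣≡1 x) ⟩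
    ∣ p ∣ + 1           ≡⟨ +-comm ∣ p ∣ 1 ⟩
    suc ∣ p ∣           ∎
    where open ≡-Reasoning

  p⊆q⇒p∪[q─p]≡q : ∀ {n} {p q : Subset n} → p ⊆ q → p ∪ (q ─ p) ≡ q
  p⊆q⇒p∪[q─p]≡q {p = p} {q} p⊆q = ⊆-antisym ⊆q q⊆
    where
    ⊆q : p ∪ (q ─ p) ⊆ q
    ⊆q x∈ with x∈p∪q⁻ p (q ─ p) x∈
    ... | inj₁ x∈p   = p⊆q x∈p
    ... | inj₂ x∈q─p = proj₁ (x∈p─q⁻ q p x∈q─p)
    q⊆ : q ⊆ p ∪ (q ─ p)
    q⊆ {x} x∈q with x ∈? p
    ... | yes x∈p = x∈p∪q⁺ (inj₁ x∈p)
    ... | no  x∉p = x∈p∪q⁺ (inj₂ (x∈p∧x∉q⇒x∈p─q x∈q x∉p))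

  p∪q─q≡p : ∀ {n} {p q : Subset n} → Disjoint p q → p ∪ q ─ q ≡ p
  p∪q─q≡p {p = p} {q} p#q = ⊆-antisym ⊆p p⊆
    where
    ⊆p : p ∪ q ─ q ⊆ p
    ⊆p x∈ with x∈p─q⁻ (p ∪ q) q x∈
    ... | x∈p∪q , x∉q with x∈p∪q⁻ p q x∈p∪q
    ...   | inj₁ x∈p = x∈p
    ...   | inj₂ x∈q = ⊥-elim (x∉q x∈q)
    p⊆ : p ⊆ p ∪ q ─ q
    p⊆ x∈p = x∈p∧x∉q⇒x∈p─q (x∈p∪q⁺ (inj₁ x∈p)) (p#q x∈p)

module Rank where

  open SubsetFacts
  open import Data.Nat using (ℕ; zero; suc; _+_; _≤_; _<_; _∸_; z≤n; s≤s)
  open import Data.Nat.Properties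
    using (≤-refl; ≤-antisym; ⊔-sel; m≤n⇒m≤n⊔o; m≤n⇒m≤o⊔n; +-suc; +-comm; +-mono-≤; m∸n+n≡m; m≤n+m;
           ≡⇒≡ᵇ; module ≤-Reasoning)
  open import Data.Bool using (Bool; true; false; T; _∧_)
  open import Data.Bool.Properties using (T?; T-∧)
  open import Data.Unit using (tt)
  open import Data.List using ([]; _∷_; map; filter)
  open import Data.List.Relation.Unary.Any using (here; there)
  open import Data.List.Membership.Propositional using (lose) renaming (_∈_ to _∈ˡ_)
  open import Data.List.Membership.Propositional.Properties
    using (∈-filter⁺; ∈-filter⁻; ∈-map⁺; ∈-map⁻; ∈-concatMap⁺; foldr-selective)
  open import Data.List.Properties using (foldr-preservesᵒ)
  open import Data.Vec.Base using ([]; _∷_; here; there)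
  open import Data.Fin.Subset using (_⊆_; _─_; ⁅_⁆)
  open import Data.Fin.Subset.Properties
    using (drop-∷-⊆; ∉⊥; x∈p∩q⁺; ∣⊥∣≡0; p⊆p∪q; q⊆p∪q; p∩q⊆p; p∩q⊆q; p⊆q⇒∣p∣≤∣q∣)
  open import Data.Product using (∃; _×_; _,_; proj₁; proj₂)
  open import Data.Sum using (_⊎_; inj₁; inj₂; [_,_])
  open import Data.Empty using (⊥-elim)
  open import Function using (_∘_; Equivalence)
  open import Relation.Binary.PropositionalEquality using (refl; cong)

  T-∧⁺ : ∀ {a b} → T a → T b → T (a ∧ b)
  T-∧⁺ ta tb = Equivalence.from T-∧ (ta , tb)

  T-∧⁻ : ∀ {a b} → T (a ∧ b) → T a × T b
  T-∧⁻ = Equivalence.to T-∧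

  ⊆ᵇ⇒⊆ : ∀ {n} (A B : Subset n) → T (A ⊆ᵇ B) → A ⊆ B
  ⊆ᵇ⇒⊆ (true ∷ A)  (true ∷ B)  _  here       = here
  ⊆ᵇ⇒⊆ (true ∷ A)  (false ∷ B) () here
  ⊆ᵇ⇒⊆ (_ ∷ A)     (_ ∷ B)     t  (there x∈A) = there (⊆ᵇ⇒⊆ A B (proj₂ (T-∧⁻ t)) x∈A)

  ⊆⇒⊆ᵇ : ∀ {n} (A B : Subset n) → A ⊆ B → T (A ⊆ᵇ B)
  ⊆⇒⊆ᵇ []          []          _   = tt
  ⊆⇒⊆ᵇ (false ∷ A) (_ ∷ B)     A⊆B = ⊆⇒⊆ᵇ A B (drop-∷-⊆ A⊆B)
  ⊆⇒⊆ᵇ (true ∷ A)  (true ∷ B)  A⊆B = ⊆⇒⊆ᵇ A B (drop-∷-⊆ A⊆B)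
  ⊆⇒⊆ᵇ (true ∷ A)  (false ∷ B) A⊆B with A⊆B here
  ... | ()

  ∈-subsets : ∀ {n} (s : Subset n) → s ∈ˡ subsets n
  ∈-subsets []                = here refl
  ∈-subsets {suc n} (b ∷ s) =
    ∈-concatMap⁺ (λ s → (false ∷ s) ∷ (true ∷ s) ∷ []) (lose (∈-subsets s) (both b))
    where
    both : ∀ b → (b ∷ s) ∈ˡ ((false ∷ s) ∷ (true ∷ s) ∷ [])
    both false = here refl
    both true  = there (here refl)

  ≤-maximum : ∀ {x xs} → x ∈ˡ xs → x ≤ maximum xs
  ≤-maximum {x} {xs} x∈xs =
    foldr-preservesᵒ (λ a b → [ m≤n⇒m≤n⊔o b , m≤n⇒m≤o⊔n a ]) 0 xs (inj₂ (lose x∈xs ≤-refl))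

  Basis : ∀ {n} → SetSystem n → Subset n → Subset n → Set
  Basis M A I = T (indep M I) × I ⊆ A × ∣ I ∣ ≡ rankOf M A

  module _ {n} (M : SetSystem n) where

    private
      candidate : Subset n → Subset n → Bool
      candidate A I = indep M I ∧ (I ⊆ᵇ A)

    ∣I∣≤rankOf : ∀ {I A} → T (indep M I) → I ⊆ A → ∣ I ∣ ≤ rankOf M A
    ∣I∣≤rankOf {I} {A} iI I⊆A =
      ≤-maximum (∈-map⁺ ∣_∣ (∈-filter⁺ (T? ∘ candidate A) (∈-subsets I) (T-∧⁺ iI (⊆⇒⊆ᵇ I A I⊆A))))

    rankOf-attained : ∀ A → rankOf M A ≡ 0 ⊎ ∃ (Basis M A)
    rankOf-attained A with foldr-selective ⊔-sel 0 (map ∣_∣ (filter (T? ∘ candidate A) (subsets n)))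
    ... | inj₁ ρ≡0 = inj₁ ρ≡0
    ... | inj₂ ρ∈ with ∈-map⁻ ∣_∣ ρ∈
    ...   | I , I∈ , ρ≡∣I∣ with T-∧⁻ (proj₂ (∈-filter⁻ (T? ∘ candidate A) {xs = subsets n} I∈))
    ...     | iI , I⊆ᵇA = inj₂ (I , iI , ⊆ᵇ⇒⊆ I A I⊆ᵇA , sym ρ≡∣I∣)

  rankOf-≤ : ∀ {n} {M M′ : SetSystem n} {A A′ : Subset n} →
             (∀ {I} → T (indep M I) → I ⊆ A → T (indep M′ I) × I ⊆ A′) →
             rankOf M A ≤ rankOf M′ A′
  rankOf-≤ {M = M} {M′} {A} {A′} transfer with rankOf-attained M A
  ... | inj₁ ρ≡0 = subst (_≤ _) (sym ρ≡0) z≤n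
  ... | inj₂ (I , iI , I⊆A , ∣I∣≡ρ) with transfer iI I⊆A
  ...   | i′I , I⊆A′ = subst (_≤ _) ∣I∣≡ρ (∣I∣≤rankOf M′ i′I I⊆A′)

  r-∘ᴹ : ∀ {n} (M : SetSystem n) (A : Subset n) → r (M ∘ᴹ A) ≡ rankOf M A
  r-∘ᴹ M A = ≤-antisym (rankOf-≤ {M = M ∘ᴹ A} {M} λ i I⊆A → proj₁ (T-∧⁻ i) , I⊆A)
                       (rankOf-≤ {M = M} {M ∘ᴹ A} λ {I} i I⊆A → T-∧⁺ i (⊆⇒⊆ᵇ I A I⊆A) , I⊆A)

  module MatroidRank {n} {M : SetSystem n} (isM : IsMatroid M) where

    open IsMatroid isM

    ρ : Subset n → ℕ
    ρ = rankOf M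

    rankOf-mono : ∀ {A B} → A ⊆ B → ρ A ≤ ρ B
    rankOf-mono A⊆B = rankOf-≤ {M = M} {M} λ i I⊆A → i , A⊆B ∘ I⊆A

    basis-exists : ∀ A → ∃ (Basis M A)
    basis-exists A with rankOf-attained M A
    ... | inj₁ ρ≡0 = ⊥ , indep-∅ , (λ x∈⊥ → ⊥-elim (∉⊥ x∈⊥)) , trans (∣⊥∣≡0 n) (sym ρ≡0)
    ... | inj₂ basis = basis

    basis-extends : ∀ {K A} → T (indep M K) → K ⊆ A → ∃ λ J → Basis M A J × K ⊆ J
    basis-extends {K₀} {A} iK₀ K₀⊆A =
      grow (ρ A ∸ ∣ K₀ ∣) iK₀ K₀⊆A (m∸n+n≡m (∣I∣≤rankOf M iK₀ K₀⊆A))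
      where
      grow : ∀ d {K} → T (indep M K) → K ⊆ A → d + ∣ K ∣ ≡ ρ A → ∃ λ J → Basis M A J × K ⊆ J
      grow zero    {K} iK K⊆A ∣K∣≡ρ = K , (iK , K⊆A , ∣K∣≡ρ) , λ x∈K → x∈K
      grow (suc d) {K} iK K⊆A d+∣K∣≡ρ with basis-exists A
      ... | W , iW , W⊆A , ∣W∣≡ρ with augment K W iK iW ∣K∣<∣W∣
        where
        ∣K∣<∣W∣ : ∣ K ∣ < ∣ W ∣
        ∣K∣<∣W∣ = subst (∣ K ∣ <_) (trans d+∣K∣≡ρ (sym ∣W∣≡ρ)) (s≤s (m≤n+m ∣ K ∣ d))
      ...   | x , x∈W , x∉K , iK+x
        with grow d iK+x (∪-⊆ K⊆A (⁅x⁆⊆p (W⊆A x∈W)))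
                         (trans (cong (d +_) (∣p∪⁅x⁆∣≡1+∣p∣ K x∉K)) (trans (+-suc d ∣ K ∣) d+∣K∣≡ρ))
      ...     | J , basisJ , K+x⊆J = J , basisJ , K+x⊆J ∘ p⊆p∪q ⁅ x ⁆

    rankOf-∪-≤ : ∀ X Y → ρ (X ∪ Y) ≤ ∣ X ∣ + ρ Y
    rankOf-∪-≤ X Y with basis-exists (X ∪ Y)
    ... | W , iW , W⊆X∪Y , ∣W∣≡ρ = begin
      ρ (X ∪ Y)             ≡⟨ sym ∣W∣≡ρ ⟩
      ∣ W ∣                 ≡⟨ ∣p∣≡∣p∩q∣+∣p─q∣ W Y ⟩
      ∣ W ∩ Y ∣ + ∣ W ─ Y ∣ ≡⟨ +-comm ∣ W ∩ Y ∣ ∣ W ─ Y ∣ ⟩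
      ∣ W ─ Y ∣ + ∣ W ∩ Y ∣ ≤⟨ +-mono-≤ (p⊆q⇒∣p∣≤∣q∣ (p⊆q∪r⇒p─r⊆q W⊆X∪Y))
                                       (∣I∣≤rankOf M (hereditary W (W ∩ Y) (p∩q⊆p W Y) iW) (p∩q⊆q W Y)) ⟩
      ∣ X ∣ + ρ Y           ∎
      where open ≤-Reasoning

    base-extends : ∀ {K} → T (indep M K) → ∃ λ b → T (isBase M b) × K ⊆ b
    base-extends {K} iK with basis-extends iK (indep⊆ground K iK)
    ... | b , (ib , _ , ∣b∣≡r) , K⊆b = b , T-∧⁺ ib (≡⇒≡ᵇ ∣ b ∣ (r M) ∣b∣≡r) , K⊆b

    contraction-basis : ∀ A Z → ∃ λ I → I ⊆ A × ρ (I ∪ Z) ≡ ∣ I ∣ + ρ Z × ∣ I ∣ + ρ Z ≡ ρ (A ∪ Z)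
    contraction-basis A Z with basis-exists Z
    ... | K , iK , K⊆Z , ∣K∣≡ρZ with basis-extends iK (q⊆p∪q A Z ∘ K⊆Z)
    ...   | J , (iJ , J⊆A∪Z , ∣J∣≡ρ) , K⊆J = J ─ Z , p⊆q∪r⇒p─r⊆q J⊆A∪Z , independent , size
      where
      ∣J∩Z∣≡ρZ : ∣ J ∩ Z ∣ ≡ ρ Z
      ∣J∩Z∣≡ρZ = ≤-antisym (∣I∣≤rankOf M (hereditary J (J ∩ Z) (p∩q⊆p J Z) iJ) (p∩q⊆q J Z))
                           (subst (_≤ ∣ J ∩ Z ∣) ∣K∣≡ρZ (p⊆q⇒∣p∣≤∣q∣ λ x∈K → x∈p∩q⁺ (K⊆J x∈K , K⊆Z x∈K)))
      ∣J─Z∣+ρZ≡∣J∣ : ∣ J ─ Z ∣ + ρ Z ≡ ∣ J ∣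
      ∣J─Z∣+ρZ≡∣J∣ = trans (+-comm ∣ J ─ Z ∣ (ρ Z))
                           (trans (cong (_+ ∣ J ─ Z ∣) (sym ∣J∩Z∣≡ρZ)) (sym (∣p∣≡∣p∩q∣+∣p─q∣ J Z)))
      independent : ρ ((J ─ Z) ∪ Z) ≡ ∣ J ─ Z ∣ + ρ Z
      independent = ≤-antisym (rankOf-∪-≤ (J ─ Z) Z)
                              (subst (_≤ ρ ((J ─ Z) ∪ Z)) (sym ∣J─Z∣+ρZ≡∣J∣) (∣I∣≤rankOf M iJ (p⊆[p─q]∪q J Z)))
      size : ∣ J ─ Z ∣ + ρ Z ≡ ρ (A ∪ Z)
      size = trans ∣J─Z∣+ρZ≡∣J∣ ∣J∣≡ρ

module Arithmetic where

  open import Data.Nat using (_+_; _≤_)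
  open import Data.Nat.Properties using (+-comm; +-identityʳ; +-assoc; +-cancelʳ-≡)
  open import Data.Integer using (+_; _-_; _⊖_) renaming (_≤_ to _≤ℤ_)
  open import Data.Integer.Properties using ([+m]-[+n]≡m⊖n; +-cancelˡ-⊖; ⊖-monoˡ-≤)
  open import Function using (_⇔_; mk⇔)
  open import Relation.Binary.PropositionalEquality using (cong; cong₂; subst₂; module ≡-Reasoning)

  [+m]-[+n]≡[+[m+k]]-[+[n+k]] : ∀ m n k → + m - + n ≡ + (m + k) - + (n + k)
  [+m]-[+n]≡[+[m+k]]-[+[n+k]] m n k = begin
    + m - + n              ≡⟨ [+m]-[+n]≡m⊖n m n ⟩
    m ⊖ n                  ≡⟨ sym (+-cancelˡ-⊖ k m n) ⟩
    (k + m) ⊖ (k + n)      ≡⟨ cong₂ _⊖_ (+-comm k m) (+-comm k n) ⟩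
    (m + k) ⊖ (n + k)      ≡⟨ sym ([+m]-[+n]≡m⊖n (m + k) (n + k)) ⟩
    + (m + k) - + (n + k)  ∎
    where open ≡-Reasoning

  m≤n+k⇒[+m]-[+n]≤+k : ∀ {m n k} → m ≤ n + k → + m - + n ≤ℤ + k
  m≤n+k⇒[+m]-[+n]≤+k {m} {n} {k} m≤n+k =
    subst₂ _≤ℤ_ (sym ([+m]-[+n]≡m⊖n m n)) [n+k]⊖n≡k (⊖-monoˡ-≤ n m≤n+k)
    where
    [n+k]⊖n≡k : (n + k) ⊖ n ≡ + k
    [n+k]⊖n≡k = trans (cong ((n + k) ⊖_) (sym (+-identityʳ n))) (+-cancelˡ-⊖ n k 0)

  +-shift-⇔ : ∀ {a b z a′ b′} i → a + z ≡ a′ → b + z ≡ b′ → a ≡ i + b ⇔ a′ ≡ i + b′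
  +-shift-⇔ {a} {b} {z} {a′} {b′} i a+z≡a′ b+z≡b′ = mk⇔ to from
    where
    open ≡-Reasoning
    to : a ≡ i + b → a′ ≡ i + b′
    to a≡i+b = begin
      a′            ≡⟨ sym a+z≡a′ ⟩
      a + z         ≡⟨ cong (_+ z) a≡i+b ⟩
      i + b + z     ≡⟨ +-assoc i b z ⟩
      i + (b + z)   ≡⟨ cong (λ k → i + k) b+z≡b′ ⟩
      i + b′        ∎
    from : a′ ≡ i + b′ → a ≡ i + b
    from a′≡i+b′ = +-cancelʳ-≡ z a (i + b) (begin
      a + z         ≡⟨ a+z≡a′ ⟩
      a′            ≡⟨ a′≡i+b′ ⟩
      i + b′        ≡⟨ cong (λ k → i + k) (sym b+z≡b′) ⟩
      i + (b + z)   ≡⟨ sym (+-assoc i b z) ⟩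
      i + b + z     ∎)

module Contraction where

  open SubsetFacts
  open Rank
  open import Data.Nat using (_+_; _≤_)
  open import Data.Nat.Properties
    using (≤-antisym; +-assoc; +-cancelʳ-≡; +-monoˡ-≤; ≡⇒≡ᵇ; ≡ᵇ⇒≡; module ≤-Reasoning)
  open import Data.Bool using (T)
  open import Data.Fin.Subset using (_⊆_; _─_)
  open import Data.Fin.Subset.Properties using (∪-assoc; p─q⊆p; p⊆p∪q; q⊆p∪q)
  open import Data.Product using (∃; _×_; _,_; proj₁; proj₂)
  open import Data.Sum using (inj₁; inj₂)
  open import Function using (_∘_; _⇔_; mk⇔; Equivalence)
  open import Relation.Binary.PropositionalEquality using (cong; module ≡-Reasoning)
  open import Data.Integer using (+_; _-_)
  open Arithmetic using (+-shift-⇔; [+m]-[+n]≡[+[m+k]]-[+[n+k]])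

  IsContraction : ∀ {n} → SetSystem n → Subset n → SetSystem n → Set
  IsContraction N Z C = ∀ I → T (indep C I) ⇔ (I ⊆ ground C × rankOf N (I ∪ Z) ≡ ∣ I ∣ + rankOf N Z)

  ×ᴹ-contracts : ∀ {n} (M : SetSystem n) (A : Subset n) → IsContraction M (ground M ─ A) (M ×ᴹ A)
  ×ᴹ-contracts M A I = mk⇔ to from
    where
    Z = ground M ─ A
    to : T (indep (M ×ᴹ A) I) → I ⊆ A × rankOf M (I ∪ Z) ≡ ∣ I ∣ + rankOf M Z
    to t = ⊆ᵇ⇒⊆ I A (proj₁ (T-∧⁻ t)) , ≡ᵇ⇒≡ _ _ (proj₂ (T-∧⁻ t))
    from : I ⊆ A × rankOf M (I ∪ Z) ≡ ∣ I ∣ + rankOf M Z → T (indep (M ×ᴹ A) I)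
    from (I⊆A , e) = T-∧⁺ (⊆⇒⊆ᵇ I A I⊆A) (≡⇒≡ᵇ _ _ e)

  module _ {n} {N : SetSystem n} (isN : IsMatroid N) where

    open MatroidRank isN

    rankOf-contraction : ∀ {Z C A} → IsContraction N Z C → A ⊆ ground C → rankOf C A + ρ Z ≡ ρ (A ∪ Z)
    rankOf-contraction {Z} {C} {A} C≅N/Z A⊆G = ≤-antisym ≤ρ[A∪Z] ρ[A∪Z]≤
      where
      open ≤-Reasoning
      ≤ρ[A∪Z] : rankOf C A + ρ Z ≤ ρ (A ∪ Z)
      ≤ρ[A∪Z] with rankOf-attained C A
      ... | inj₁ rankOf≡0 = subst (λ k → k + ρ Z ≤ ρ (A ∪ Z)) (sym rankOf≡0) (rankOf-mono (q⊆p∪q A Z))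
      ... | inj₂ (W , iW , W⊆A , ∣W∣≡rankOf) = begin
        rankOf C A + ρ Z   ≡⟨ cong (_+ ρ Z) (sym ∣W∣≡rankOf) ⟩
        ∣ W ∣ + ρ Z        ≡⟨ sym (proj₂ (Equivalence.to (C≅N/Z W) iW)) ⟩
        ρ (W ∪ Z)          ≤⟨ rankOf-mono (∪-⊆ (p⊆p∪q Z ∘ W⊆A) (q⊆p∪q A Z)) ⟩
        ρ (A ∪ Z)          ∎
      ρ[A∪Z]≤ : ρ (A ∪ Z) ≤ rankOf C A + ρ Z
      ρ[A∪Z]≤ = from-basis (contraction-basis A Z)
        where
        from-basis : ∃ (λ I → I ⊆ A × ρ (I ∪ Z) ≡ ∣ I ∣ + ρ Z × ∣ I ∣ + ρ Z ≡ ρ (A ∪ Z)) →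
                     ρ (A ∪ Z) ≤ rankOf C A + ρ Z
        from-basis (I , I⊆A , ρ[I∪Z]≡ , ∣I∣+ρZ≡ρ[A∪Z]) = begin
          ρ (A ∪ Z)          ≡⟨ sym ∣I∣+ρZ≡ρ[A∪Z] ⟩
          ∣ I ∣ + ρ Z        ≤⟨ +-monoˡ-≤ (ρ Z) (∣I∣≤rankOf C (Equivalence.from (C≅N/Z I) (A⊆G ∘ I⊆A , ρ[I∪Z]≡)) I⊆A) ⟩
          rankOf C A + ρ Z   ∎

    ×ᴹ-contracts-contraction : ∀ {Z C A} → IsContraction N Z C → A ⊆ ground C →
                               IsContraction N ((ground C ─ A) ∪ Z) (C ×ᴹ A)
    ×ᴹ-contracts-contraction {Z} {C} {A} C≅N/Z A⊆G I = mk⇔ to from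
      where
      O = ground C ─ A
      C×A≅C/O = ×ᴹ-contracts C A I
      shift : I ⊆ A → (rankOf C (I ∪ O) ≡ ∣ I ∣ + rankOf C O) ⇔ (ρ (I ∪ (O ∪ Z)) ≡ ∣ I ∣ + ρ (O ∪ Z))
      shift I⊆A = +-shift-⇔ ∣ I ∣
        (trans (rankOf-contraction C≅N/Z (∪-⊆ (A⊆G ∘ I⊆A) (p─q⊆p _ A))) (cong ρ (∪-assoc I O Z)))
        (rankOf-contraction C≅N/Z (p─q⊆p _ A))
      to : T (indep (C ×ᴹ A) I) → I ⊆ A × ρ (I ∪ (O ∪ Z)) ≡ ∣ I ∣ + ρ (O ∪ Z)
      to t with Equivalence.to C×A≅C/O t
      ... | I⊆A , e = I⊆A , Equivalence.to (shift I⊆A) e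
      from : I ⊆ A × ρ (I ∪ (O ∪ Z)) ≡ ∣ I ∣ + ρ (O ∪ Z) → T (indep (C ×ᴹ A) I)
      from (I⊆A , e) = Equivalence.from C×A≅C/O (I⊆A , Equivalence.from (shift I⊆A) e)

    r-×ᴹ : ∀ {Z C A} → IsContraction N Z C → A ⊆ ground C → r (C ×ᴹ A) + rankOf C (ground C ─ A) ≡ r C
    r-×ᴹ {Z} {C} {A} C≅N/Z A⊆G = +-cancelʳ-≡ (ρ Z) _ _ (begin
      r (C ×ᴹ A) + rankOf C O + ρ Z    ≡⟨ +-assoc (r (C ×ᴹ A)) (rankOf C O) (ρ Z) ⟩
      r (C ×ᴹ A) + (rankOf C O + ρ Z)  ≡⟨ cong (λ k → r (C ×ᴹ A) + k) (rankOf-contraction C≅N/Z (p─q⊆p G A)) ⟩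
      r (C ×ᴹ A) + ρ (O ∪ Z)           ≡⟨ rankOf-contraction (×ᴹ-contracts-contraction C≅N/Z A⊆G) (λ x∈A → x∈A) ⟩
      ρ (A ∪ (O ∪ Z))                  ≡⟨ cong ρ (sym (∪-assoc A O Z)) ⟩
      ρ ((A ∪ O) ∪ Z)                  ≡⟨ cong (λ X → ρ (X ∪ Z)) (p⊆q⇒p∪[q─p]≡q A⊆G) ⟩
      ρ (G ∪ Z)                        ≡⟨ sym (rankOf-contraction C≅N/Z (λ x∈G → x∈G)) ⟩
      r C + ρ Z                        ∎)
      where
      open ≡-Reasoning
      G = ground C
      O = G ─ A

    r∘ᴹ-r×ᴹ : ∀ {Z C A} → IsContraction N Z C → A ⊆ ground C →
              + r (C ∘ᴹ A) - + r (C ×ᴹ A) ≡ + (rankOf C A + rankOf C (ground C ─ A)) - + r C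
    r∘ᴹ-r×ᴹ {Z} {C} {A} C≅N/Z A⊆G = begin
      + r (C ∘ᴹ A) - + r (C ×ᴹ A)     ≡⟨ cong (λ k → + k - + r (C ×ᴹ A)) (r-∘ᴹ C A) ⟩
      + a - + r (C ×ᴹ A)              ≡⟨ [+m]-[+n]≡[+[m+k]]-[+[n+k]] a (r (C ×ᴹ A)) o ⟩
      + (a + o) - + (r (C ×ᴹ A) + o)  ≡⟨ cong (λ k → + (a + o) - + k) (r-×ᴹ C≅N/Z A⊆G) ⟩
      + (a + o) - + r C               ∎
      where
      open ≡-Reasoning
      a = rankOf C A
      o = rankOf C (ground C ─ A)

module MatroidUnion where

  open SubsetFacts
  open Rank
  open import Data.Nat using (ℕ; _+_; _≤_; _<_; _<?_)
  open import Data.Nat.Properties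
    using (≤-refl; +-comm; +-assoc; +-mono-≤; +-mono-≤-<; +-cancelˡ-<; ≮⇒≥; module ≤-Reasoning)
  open import Data.Nat.Induction using (<-wellFounded)
  open import Induction.WellFounded using (Acc; acc)
  open import Data.Bool using (T)
  open import Data.List.Relation.Unary.Any using (satisfied)
  open import Data.List.Relation.Unary.Any.Properties using (any⁺; any⁻)
  open import Data.List.Membership.Propositional using (lose)
  open import Data.Fin.Subset using (_∈_; _∉_; _⊆_; _─_; ⁅_⁆)
  open import Data.Fin.Subset.Properties
    using (_∈?_; ∉⊥; x∈⁅x⁆; x∈⁅y⁆⇒x≡y; x∈p∪q⁺; x∈p∪q⁻; x∈p∩q⁺; x∈p∩q⁻; p⊆p∪q; q⊆p∪q;
           p∩q⊆p; p∩q⊆q; p─q⊆p; ∪-comm; ∪-assoc; p⊆q⇒∣p∣≤∣q∣; p⊂q⇒∣p∣<∣q∣)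
  open import Data.Product using (Σ; ∃; _×_; _,_; proj₁; proj₂)
  open import Data.Sum using (_⊎_; inj₁; inj₂; [_,_])
  open import Data.Empty using (⊥-elim)
  open import Function using (_∘_)
  open import Relation.Nullary using (yes; no)
  open import Relation.Binary.PropositionalEquality using (cong; cong₂; subst₂; module ≡-Reasoning)

  ⊕𝟎-isMatroid : ∀ {n} {M : SetSystem n} → IsMatroid M → ∀ Q → IsMatroid (M ⊕𝟎 Q)
  ⊕𝟎-isMatroid isM Q = record
    { indep⊆ground = λ I iI → p⊆p∪q Q ∘ indep⊆ground I iI
    ; indep-∅      = indep-∅
    ; hereditary   = hereditary
    ; augment      = augment
    }
    where open IsMatroid isM

  module _ {n : ℕ} where

    record Covered (M₁ M₂ : SetSystem n) (I : Subset n) : Set where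
      constructor covered-by
      field
        A₁ A₂    : Subset n
        indep-A₁ : T (indep M₁ A₁)
        indep-A₂ : T (indep M₂ A₂)
        ⊆A₁∪A₂   : I ⊆ A₁ ∪ A₂

    Covered-swap : ∀ {M₁ M₂ I} → Covered M₁ M₂ I → Covered M₂ M₁ I
    Covered-swap (covered-by A₁ A₂ iA₁ iA₂ I⊆A₁∪A₂) =
      covered-by A₂ A₁ iA₂ iA₁ (subst (_ ⊆_) (∪-comm A₁ A₂) I⊆A₁∪A₂)

    Covered-mono : ∀ {M₁ M₂ I J} → J ⊆ I → Covered M₁ M₂ I → Covered M₁ M₂ J
    Covered-mono J⊆I (covered-by A₁ A₂ iA₁ iA₂ I⊆A₁∪A₂) = covered-by A₁ A₂ iA₁ iA₂ (I⊆A₁∪A₂ ∘ J⊆I)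

    ∨ᴹ-indep⁻ : ∀ {M₁ M₂ I} → T (indep (M₁ ∨ᴹ M₂) I) → Covered M₁ M₂ I
    ∨ᴹ-indep⁻ {M₁} {M₂} {I} t with satisfied (any⁻ _ (subsets n) t)
    ... | b₁ , t₁ with T-∧⁻ t₁
    ...   | base₁ , t₂ with satisfied (any⁻ _ (subsets n) t₂)
    ...     | b₂ , t₃ with T-∧⁻ t₃
    ...       | base₂ , I⊆ᵇb₁∪b₂ =
      covered-by b₁ b₂ (proj₁ (T-∧⁻ base₁)) (proj₁ (T-∧⁻ base₂)) (⊆ᵇ⇒⊆ I (b₁ ∪ b₂) I⊆ᵇb₁∪b₂)

    ∨ᴹ-indep⁺ : ∀ {M₁ M₂ I} → IsMatroid M₁ → IsMatroid M₂ → Covered M₁ M₂ I → T (indep (M₁ ∨ᴹ M₂) I)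
    ∨ᴹ-indep⁺ {M₁} {M₂} {I} isM₁ isM₂ (covered-by A₁ A₂ iA₁ iA₂ I⊆A₁∪A₂)
      with MatroidRank.base-extends isM₁ iA₁ | MatroidRank.base-extends isM₂ iA₂
    ... | b₁ , base₁ , A₁⊆b₁ | b₂ , base₂ , A₂⊆b₂ =
      any⁺ _ (lose (∈-subsets b₁) (T-∧⁺ base₁
        (any⁺ _ (lose (∈-subsets b₂) (T-∧⁺ base₂ (⊆⇒⊆ᵇ I (b₁ ∪ b₂) (∪-mono-⊆ A₁⊆b₁ A₂⊆b₂ ∘ I⊆A₁∪A₂)))))))

    record Split (M₁ M₂ : SetSystem n) (I : Subset n) : Set where
      field
        part₁    : Subset n
        part₂    : Subset n
        indep₁   : T (indep M₁ part₁)
        indep₂   : T (indep M₂ part₂)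
        disjoint : Disjoint part₁ part₂
        covers   : part₁ ∪ part₂ ≡ I

      ∣I∣≡∣part₁∣+∣part₂∣ : ∣ I ∣ ≡ ∣ part₁ ∣ + ∣ part₂ ∣
      ∣I∣≡∣part₁∣+∣part₂∣ = trans (cong ∣_∣ (sym covers)) (∣p∪q∣≡∣p∣+∣q∣ part₁ part₂ disjoint)

      ⊆parts : I ⊆ part₁ ∪ part₂
      ⊆parts = subst (I ⊆_) (sym covers) (λ x∈I → x∈I)

      parts⊆ : part₁ ∪ part₂ ⊆ I
      parts⊆ = subst (_⊆ I) (sym covers) (λ x∈I → x∈I)

    open Split

    Split-swap : ∀ {M₁ M₂ I} → Split M₁ M₂ I → Split M₂ M₁ I
    Split-swap s = record
      { part₁ = part₂ s ; part₂ = part₁ s ; indep₁ = indep₂ s ; indep₂ = indep₁ s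
      ; disjoint = λ x∈part₂ x∈part₁ → disjoint s x∈part₁ x∈part₂
      ; covers = trans (∪-comm (part₂ s) (part₁ s)) (covers s) }

    Covered⇒Split : ∀ {M₁ M₂ I} → IsMatroid M₁ → IsMatroid M₂ → Covered M₁ M₂ I → Split M₁ M₂ I
    Covered⇒Split {I = I} isM₁ isM₂ (covered-by A₁ A₂ iA₁ iA₂ I⊆A₁∪A₂) = record
      { part₁ = I ─ A₂ ; part₂ = I ∩ A₂
      ; indep₁ = IsMatroid.hereditary isM₁ A₁ (I ─ A₂) (p⊆q∪r⇒p─r⊆q I⊆A₁∪A₂) iA₁
      ; indep₂ = IsMatroid.hereditary isM₂ A₂ (I ∩ A₂) (p∩q⊆q I A₂) iA₂
      ; disjoint = λ x∈I─A₂ x∈I∩A₂ → proj₂ (x∈p─q⁻ I A₂ x∈I─A₂) (p∩q⊆q I A₂ x∈I∩A₂)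
      ; covers = [p─q]∪[p∩q]≡p I A₂ }

    -- The exchange argument terminates because every step lowers the number of elements of I ∩ J
    -- that the splittings of I and J put on different sides.
    mismatch : ∀ {M₁ M₂ I J} → Split M₁ M₂ I → Split M₁ M₂ J → ℕ
    mismatch sI sJ = ∣ part₁ sI ∩ part₂ sJ ∣ + ∣ part₂ sI ∩ part₁ sJ ∣

    Exchange : SetSystem n → SetSystem n → Subset n → Subset n → Set
    Exchange M₁ M₂ I J = ∃ λ x → x ∈ J × x ∉ I × Covered M₁ M₂ (I ∪ ⁅ x ⁆)

    module _ {M₁ M₂ : SetSystem n} (isM₂ : IsMatroid M₂) {I : Subset n} (sI : Split M₁ M₂ I)
             {x} (x∈part₂ : x ∈ part₂ sI) (i[part₁+x] : T (indep M₁ (part₁ sI ∪ ⁅ x ⁆))) where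

      move : Split M₁ M₂ I
      move = record
        { part₁ = part₁ sI ∪ ⁅ x ⁆ ; part₂ = part₂ sI ─ ⁅ x ⁆
        ; indep₁ = i[part₁+x]
        ; indep₂ = IsMatroid.hereditary isM₂ (part₂ sI) _ (p─q⊆p (part₂ sI) ⁅ x ⁆) (indep₂ sI)
        ; disjoint = disjoint′
        ; covers = begin
            (part₁ sI ∪ ⁅ x ⁆) ∪ (part₂ sI ─ ⁅ x ⁆) ≡⟨ ∪-assoc (part₁ sI) ⁅ x ⁆ _ ⟩
            part₁ sI ∪ (⁅ x ⁆ ∪ (part₂ sI ─ ⁅ x ⁆)) ≡⟨ cong (part₁ sI ∪_) (p⊆q⇒p∪[q─p]≡q (⁅x⁆⊆p x∈part₂)) ⟩
            part₁ sI ∪ part₂ sI                    ≡⟨ covers sI ⟩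
            I                                       ∎ }
        where
        open ≡-Reasoning
        disjoint′ : Disjoint (part₁ sI ∪ ⁅ x ⁆) (part₂ sI ─ ⁅ x ⁆)
        disjoint′ {y} y∈part₁+x y∈part₂─x with x∈p─q⁻ (part₂ sI) ⁅ x ⁆ y∈part₂─x
        ... | y∈part₂ , y∉⁅x⁆ =
          [ (λ y∈part₁ → disjoint sI y∈part₁ y∈part₂) , y∉⁅x⁆ ] (x∈p∪q⁻ (part₁ sI) ⁅ x ⁆ y∈part₁+x)

      move-mismatch : ∀ {J} (sJ : Split M₁ M₂ J) → x ∈ part₁ sJ → mismatch move sJ < mismatch sI sJ
      move-mismatch sJ x∈J₁ = +-mono-≤-< (p⊆q⇒∣p∣≤∣q∣ kept) (p⊂q⇒∣p∣<∣q∣ (shrunk , x , x∈p∩q⁺ (x∈part₂ , x∈J₁) , x∉))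
        where
        kept : (part₁ sI ∪ ⁅ x ⁆) ∩ part₂ sJ ⊆ part₁ sI ∩ part₂ sJ
        kept {y} y∈ with x∈p∩q⁻ _ _ y∈
        ... | y∈part₁+x , y∈J₂ with x∈p∪q⁻ (part₁ sI) ⁅ x ⁆ y∈part₁+x
        ...   | inj₁ y∈part₁ = x∈p∩q⁺ (y∈part₁ , y∈J₂)
        ...   | inj₂ y∈⁅x⁆   = ⊥-elim (disjoint sJ x∈J₁ (subst (_∈ part₂ sJ) (x∈⁅y⁆⇒x≡y x y∈⁅x⁆) y∈J₂))
        shrunk : (part₂ sI ─ ⁅ x ⁆) ∩ part₁ sJ ⊆ part₂ sI ∩ part₁ sJ
        shrunk y∈ with x∈p∩q⁻ _ _ y∈
        ... | y∈part₂─x , y∈J₁ = x∈p∩q⁺ (p─q⊆p _ ⁅ x ⁆ y∈part₂─x , y∈J₁)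
        x∉ : x ∉ (part₂ sI ─ ⁅ x ⁆) ∩ part₁ sJ
        x∉ x∈ = proj₂ (x∈p─q⁻ (part₂ sI) ⁅ x ⁆ (proj₁ (x∈p∩q⁻ _ _ x∈))) (x∈⁅x⁆ x)

    exchange-step : ∀ {M₁ M₂ I J} → IsMatroid M₁ → IsMatroid M₂ →
                    (sI : Split M₁ M₂ I) (sJ : Split M₁ M₂ J) → ∣ part₁ sI ∣ < ∣ part₁ sJ ∣ →
                    Exchange M₁ M₂ I J ⊎ Σ (Split M₁ M₂ I) λ sI′ → mismatch sI′ sJ < mismatch sI sJ
    exchange-step {I = I} isM₁ isM₂ sI sJ ∣I₁∣<∣J₁∣
      with IsMatroid.augment isM₁ (part₁ sI) (part₁ sJ) (indep₁ sI) (indep₁ sJ) ∣I₁∣<∣J₁∣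
    ... | x , x∈J₁ , x∉I₁ , i[I₁+x] with x ∈? part₂ sI
    ...   | yes x∈I₂ = inj₂ (move isM₂ sI x∈I₂ i[I₁+x] , move-mismatch isM₂ sI x∈I₂ i[I₁+x] sJ x∈J₁)
    ...   | no  x∉I₂ =
      inj₁ (x , parts⊆ sJ (x∈p∪q⁺ (inj₁ x∈J₁)) , x∉I , covered-by _ (part₂ sI) i[I₁+x] (indep₂ sI) I+x⊆)
      where
      x∉I : x ∉ I
      x∉I x∈I = [ x∉I₁ , x∉I₂ ] (x∈p∪q⁻ (part₁ sI) (part₂ sI) (⊆parts sI x∈I))
      I+x⊆ : I ∪ ⁅ x ⁆ ⊆ (part₁ sI ∪ ⁅ x ⁆) ∪ part₂ sI
      I+x⊆ = ∪-⊆ (∪-mono-⊆ (p⊆p∪q ⁅ x ⁆) (λ y∈ → y∈) ∘ ⊆parts sI) (p⊆p∪q (part₂ sI) ∘ q⊆p∪q (part₁ sI) ⁅ x ⁆)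

    larger-part : ∀ {M₁ M₂ I J} (sI : Split M₁ M₂ I) (sJ : Split M₁ M₂ J) → ∣ I ∣ < ∣ J ∣ →
                  ∣ part₁ sI ∣ < ∣ part₁ sJ ∣ ⊎ ∣ part₂ sI ∣ < ∣ part₂ sJ ∣
    larger-part {I = I} {J} sI sJ ∣I∣<∣J∣ with ∣ part₁ sI ∣ <? ∣ part₁ sJ ∣
    ... | yes ∣I₁∣<∣J₁∣ = inj₁ ∣I₁∣<∣J₁∣
    ... | no  ∣I₁∣≮∣J₁∣ = inj₂ (+-cancelˡ-< ∣ part₁ sI ∣ _ _ (begin-strict
      ∣ part₁ sI ∣ + ∣ part₂ sI ∣ ≡⟨ sym (∣I∣≡∣part₁∣+∣part₂∣ sI) ⟩
      ∣ I ∣                       <⟨ ∣I∣<∣J∣ ⟩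
      ∣ J ∣                       ≡⟨ ∣I∣≡∣part₁∣+∣part₂∣ sJ ⟩
      ∣ part₁ sJ ∣ + ∣ part₂ sJ ∣ ≤⟨ +-mono-≤ (≮⇒≥ ∣I₁∣≮∣J₁∣) ≤-refl ⟩
      ∣ part₁ sI ∣ + ∣ part₂ sJ ∣ ∎))
      where open ≤-Reasoning

    exchange : ∀ {M₁ M₂ I J} → IsMatroid M₁ → IsMatroid M₂ →
               (sI : Split M₁ M₂ I) (sJ : Split M₁ M₂ J) → Acc _<_ (mismatch sI sJ) →
               ∣ I ∣ < ∣ J ∣ → Exchange M₁ M₂ I J
    exchange isM₁ isM₂ sI sJ (acc smaller) ∣I∣<∣J∣ with larger-part sI sJ ∣I∣<∣J∣
    ... | inj₁ ∣I₁∣<∣J₁∣ with exchange-step isM₁ isM₂ sI sJ ∣I₁∣<∣J₁∣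
    ...   | inj₁ done          = done
    ...   | inj₂ (sI′ , fewer) = exchange isM₁ isM₂ sI′ sJ (smaller fewer) ∣I∣<∣J∣
    exchange isM₁ isM₂ sI sJ (acc smaller) ∣I∣<∣J∣ | inj₂ ∣I₂∣<∣J₂∣
      with exchange-step isM₂ isM₁ (Split-swap sI) (Split-swap sJ) ∣I₂∣<∣J₂∣
    ...   | inj₁ (x , x∈J , x∉I , covered) = x , x∈J , x∉I , Covered-swap covered
    ...   | inj₂ (sI′ , fewer) = exchange isM₁ isM₂ (Split-swap sI′) sJ (smaller fewer′) ∣I∣<∣J∣
      where
      fewer′ : mismatch (Split-swap sI′) sJ < mismatch sI sJ
      fewer′ = subst₂ _<_ (+-comm ∣ part₁ sI′ ∩ part₁ sJ ∣ ∣ part₂ sI′ ∩ part₂ sJ ∣)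
                          (+-comm ∣ part₂ sI ∩ part₁ sJ ∣ ∣ part₁ sI ∩ part₂ sJ ∣) fewer

    ∨ᴹ-isMatroid : ∀ {M₁ M₂} → IsMatroid M₁ → IsMatroid M₂ → ground M₂ ⊆ ground M₁ → IsMatroid (M₁ ∨ᴹ M₂)
    ∨ᴹ-isMatroid {M₁} {M₂} isM₁ isM₂ G₂⊆G₁ = record
      { indep⊆ground = λ I iI → ⊆ground (∨ᴹ-indep⁻ iI)
      ; indep-∅      = ∨ᴹ-indep⁺ isM₁ isM₂
                         (covered-by ⊥ ⊥ (IsMatroid.indep-∅ isM₁) (IsMatroid.indep-∅ isM₂) (⊥-elim ∘ ∉⊥))
      ; hereditary   = λ I J J⊆I iI → ∨ᴹ-indep⁺ isM₁ isM₂ (Covered-mono J⊆I (∨ᴹ-indep⁻ iI))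
      ; augment      = augment
      }
      where
      ⊆ground : ∀ {I} → Covered M₁ M₂ I → I ⊆ ground M₁
      ⊆ground (covered-by A₁ A₂ iA₁ iA₂ I⊆A₁∪A₂) =
        ∪-⊆ (IsMatroid.indep⊆ground isM₁ A₁ iA₁) (G₂⊆G₁ ∘ IsMatroid.indep⊆ground isM₂ A₂ iA₂) ∘ I⊆A₁∪A₂
      split : ∀ {I} → T (indep (M₁ ∨ᴹ M₂) I) → Split M₁ M₂ I
      split = Covered⇒Split isM₁ isM₂ ∘ ∨ᴹ-indep⁻
      augment : ∀ I J → T (indep (M₁ ∨ᴹ M₂) I) → T (indep (M₁ ∨ᴹ M₂) J) → ∣ I ∣ < ∣ J ∣ →
                ∃ λ x → x ∈ J × x ∉ I × T (indep (M₁ ∨ᴹ M₂) (I ∪ ⁅ x ⁆))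
      augment I J iI iJ ∣I∣<∣J∣ with exchange isM₁ isM₂ (split iI) (split iJ) (<-wellFounded _) ∣I∣<∣J∣
      ... | x , x∈J , x∉I , covered = x , x∈J , x∉I , ∨ᴹ-indep⁺ isM₁ isM₂ covered

    module _ {M₁ M₂ : SetSystem n} (isM₁ : IsMatroid M₁) (isM₂ : IsMatroid M₂) (G₂⊆G₁ : ground M₂ ⊆ ground M₁) where

      open MatroidRank (∨ᴹ-isMatroid isM₁ isM₂ G₂⊆G₁)

      -- A basis W of A is M₁-independent since A misses E₂. Split a basis V of B along the M₂-set c₂
      -- of its cover: W ∪ (V ∩ c₂) is independent in A ∪ B, and V ─ c₂ lies in E₁ ∩ B ⊆ C.
      rankOf-∨ᴹ-≤ : ∀ {E₁ E₂ A B C} →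
                    (∀ I → T (indep M₁ I) → I ⊆ E₁) → (∀ I → T (indep M₂ I) → I ⊆ E₂) →
                    Disjoint A E₂ → E₁ ∩ B ⊆ C →
                    ρ A + ρ B ≤ ρ (A ∪ B) + ρ C
      rankOf-∨ᴹ-≤ {E₁} {E₂} {A} {B} {C} ⊆E₁ ⊆E₂ A#E₂ E₁∩B⊆C
        with basis-exists A | basis-exists B
      ... | W , iW , W⊆A , ∣W∣≡ρA | V , iV , V⊆B , ∣V∣≡ρB
        with ∨ᴹ-indep⁻ iW | ∨ᴹ-indep⁻ iV
      ... | covered-by a₁ a₂ ia₁ ia₂ W⊆a₁∪a₂ | covered-by c₁ c₂ ic₁ ic₂ V⊆c₁∪c₂ = begin
        ρ A + ρ B                           ≡⟨ cong₂ _+_ (sym ∣W∣≡ρA) (sym ∣V∣≡ρB) ⟩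
        ∣ W ∣ + ∣ V ∣                       ≡⟨ cong (∣ W ∣ +_) (∣p∣≡∣p∩q∣+∣p─q∣ V c₂) ⟩
        ∣ W ∣ + (∣ V ∩ c₂ ∣ + ∣ V ─ c₂ ∣)   ≡⟨ sym (+-assoc ∣ W ∣ (∣ V ∩ c₂ ∣) (∣ V ─ c₂ ∣)) ⟩
        ∣ W ∣ + ∣ V ∩ c₂ ∣ + ∣ V ─ c₂ ∣     ≡⟨ cong (_+ ∣ V ─ c₂ ∣) (sym (∣p∪q∣≡∣p∣+∣q∣ W (V ∩ c₂) W#V∩c₂)) ⟩
        ∣ W ∪ (V ∩ c₂) ∣ + ∣ V ─ c₂ ∣       ≤⟨ +-mono-≤ (∣I∣≤rankOf U i[W∪V∩c₂] (∪-mono-⊆ W⊆A (V⊆B ∘ p∩q⊆p V c₂)))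
                                                       (∣I∣≤rankOf U i[V─c₂] V─c₂⊆C) ⟩
        ρ (A ∪ B) + ρ C                     ∎
        where
        open ≤-Reasoning
        U = M₁ ∨ᴹ M₂
        W⊆a₁ : W ⊆ a₁
        W⊆a₁ x∈W = [ (λ x∈a₁ → x∈a₁) , (λ x∈a₂ → ⊥-elim (A#E₂ (W⊆A x∈W) (⊆E₂ a₂ ia₂ x∈a₂))) ]
                     (x∈p∪q⁻ a₁ a₂ (W⊆a₁∪a₂ x∈W))
        W#V∩c₂ : Disjoint W (V ∩ c₂)
        W#V∩c₂ x∈W x∈V∩c₂ = A#E₂ (W⊆A x∈W) (⊆E₂ c₂ ic₂ (p∩q⊆q V c₂ x∈V∩c₂))
        i[W∪V∩c₂] : T (indep U (W ∪ (V ∩ c₂)))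
        i[W∪V∩c₂] = ∨ᴹ-indep⁺ isM₁ isM₂
          (covered-by W (V ∩ c₂)
            (IsMatroid.hereditary isM₁ a₁ W W⊆a₁ ia₁) (IsMatroid.hereditary isM₂ c₂ (V ∩ c₂) (p∩q⊆q V c₂) ic₂)
            (λ x∈ → x∈))
        i[V─c₂] : T (indep U (V ─ c₂))
        i[V─c₂] = IsMatroid.hereditary (∨ᴹ-isMatroid isM₁ isM₂ G₂⊆G₁) V (V ─ c₂) (p─q⊆p V c₂) iV
        V─c₂⊆C : V ─ c₂ ⊆ C
        V─c₂⊆C x∈V─c₂ = E₁∩B⊆C (x∈p∩q⁺ (⊆E₁ c₁ ic₁ (p⊆q∪r⇒p─r⊆q V⊆c₁∪c₂ x∈V─c₂) , V⊆B (p─q⊆p V c₂ x∈V─c₂)))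

open SubsetFacts using (Disjoint; ∩≡⊥⇒Disjoint)

module Linking {n} (S P Q : Subset n) (S#P : Disjoint S P) (P#Q : Disjoint P Q) (S#Q : Disjoint S Q)
               {Msp Mpq : SetSystem n} (isMsp : IsMatroid Msp) (isMpq : IsMatroid Mpq)
               (groundSP : ground Msp ≡ S ∪ P) (groundPQ : ground Mpq ≡ P ∪ Q) where

  open SubsetFacts
  open Rank
  open Contraction
  open MatroidUnion
  open import Data.Nat using (_+_; _≤_)
  open import Data.Nat.Properties
    using (+-comm; +-mono-≤; +-monoˡ-≤; +-assoc; +-cancelʳ-≤; ≤-trans; ≤-reflexive; module ≤-Reasoning)
  open import Data.Nat.Tactic.RingSolver using (solve-∀)
  import Data.Integer as ℤ
  open ℤ using (ℤ; +_; _-_)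
  open Arithmetic using (m≤n+k⇒[+m]-[+n]≤+k)
  open import Data.Fin.Subset using (_⊆_; _─_)
  open import Data.Fin.Subset.Properties
    using (⊆-reflexive; x∈p∪q⁻; x∈p∩q⁻; p⊆p∪q; q⊆p∪q; ∪-comm; ∪-assoc; p⊆q⇒∣p∣≤∣q∣)
  open import Data.Product using (_,_)
  open import Data.Sum using ([_,_])
  open import Data.Empty using (⊥-elim)
  open import Function using (_∘_)
  open import Relation.Binary.PropositionalEquality using (cong; cong₂)

  private
    M₁ = Msp ⊕𝟎 Q
    M₂ = Mpq ⊕𝟎 S
    U  = M₁ ∨ᴹ M₂
    -- This is P, but only Z ⊆ P is needed.
    Z  = ground U ─ (S ∪ Q)

    ground₂⊆ground₁ : ground M₂ ⊆ ground M₁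
    ground₂⊆ground₁ = ∪-mono-⊆ (⊆-reflexive (sym groundSP)) (λ x∈Q → x∈Q)
                    ∘ ∪-⊆ (∪-⊆ (p⊆p∪q Q ∘ q⊆p∪q S P) (q⊆p∪q (S ∪ P) Q)) (p⊆p∪q Q ∘ p⊆p∪q P)
                    ∘ ∪-mono-⊆ (⊆-reflexive groundPQ) (λ x∈S → x∈S)

  isU : IsMatroid U
  isU = ∨ᴹ-isMatroid (⊕𝟎-isMatroid isMsp Q) (⊕𝟎-isMatroid isMpq S) ground₂⊆ground₁

  open MatroidRank isU

  Msq : SetSystem n
  Msq = link S Q Msp Mpq

  Msq-contracts : IsContraction U Z Msq
  Msq-contracts = ×ᴹ-contracts U (S ∪ Q)

  rankOf-S+rankOf-Q≤r+∣P∣ : rankOf Msq S + rankOf Msq Q ≤ r Msq + ∣ P ∣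
  rankOf-S+rankOf-Q≤r+∣P∣ = +-cancelʳ-≤ (ρ Z + ρ Z) _ _ (begin
    s + q + (ρ Z + ρ Z)             ≡⟨ regroup s q (ρ Z) ⟩
    (s + ρ Z) + (q + ρ Z)           ≡⟨ cong₂ _+_ (rankOf-contraction isU Msq-contracts (p⊆p∪q Q))
                                                 (rankOf-contraction isU Msq-contracts (q⊆p∪q S Q)) ⟩
    ρ (S ∪ Z) + ρ (Q ∪ Z)           ≤⟨ +-monoˡ-≤ (ρ (Q ∪ Z)) ρ[S∪Z]≤ ⟩
    ∣ Z ∣ + ρ S + ρ (Q ∪ Z)         ≡⟨ +-assoc ∣ Z ∣ (ρ S) (ρ (Q ∪ Z)) ⟩
    ∣ Z ∣ + (ρ S + ρ (Q ∪ Z))       ≤⟨ +-mono-≤ (p⊆q⇒∣p∣≤∣q∣ Z⊆P) separated ⟩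
    ∣ P ∣ + (ρ (S ∪ (Q ∪ Z)) + ρ Z) ≡⟨ cong (λ k → ∣ P ∣ + (k + ρ Z)) ρ[S∪Q∪Z]≡ ⟩
    ∣ P ∣ + (g + ρ Z + ρ Z)         ≡⟨ regroup′ (∣ P ∣) g (ρ Z) ⟩
    g + ∣ P ∣ + (ρ Z + ρ Z)         ∎)
    where
    open ≤-Reasoning
    s = rankOf Msq S
    q = rankOf Msq Q
    g = r Msq
    regroup : ∀ a b z → a + b + (z + z) ≡ (a + z) + (b + z)
    regroup = solve-∀
    regroup′ : ∀ p c z → p + (c + z + z) ≡ c + p + (z + z)
    regroup′ = solve-∀
    ρ[S∪Z]≤ : ρ (S ∪ Z) ≤ ∣ Z ∣ + ρ S
    ρ[S∪Z]≤ = ≤-trans (≤-reflexive (cong ρ (∪-comm S Z))) (rankOf-∪-≤ Z S)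
    Z⊆P : Z ⊆ P
    Z⊆P = p⊆q∪r⇒p─r⊆q (∪-⊆ (∪-⊆ (q⊆p∪q P (S ∪ Q) ∘ p⊆p∪q Q) (p⊆p∪q (S ∪ Q)) ∘ ⊆-reflexive groundSP)
                            (q⊆p∪q P (S ∪ Q) ∘ q⊆p∪q S Q))
    overlap⊆Z : (S ∪ P) ∩ (Q ∪ Z) ⊆ Z
    overlap⊆Z x∈ with x∈p∩q⁻ (S ∪ P) (Q ∪ Z) x∈
    ... | x∈S∪P , x∈Q∪Z =
      [ (λ x∈Q → ⊥-elim ([ (λ x∈S → S#Q x∈S x∈Q) , (λ x∈P → P#Q x∈P x∈Q) ] (x∈p∪q⁻ S P x∈S∪P)))
      , (λ x∈Z → x∈Z) ] (x∈p∪q⁻ Q Z x∈Q∪Z)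
    separated : ρ S + ρ (Q ∪ Z) ≤ ρ (S ∪ (Q ∪ Z)) + ρ Z
    separated = rankOf-∨ᴹ-≤ (⊕𝟎-isMatroid isMsp Q) (⊕𝟎-isMatroid isMpq S) ground₂⊆ground₁
      (λ I iI → ⊆-reflexive groundSP ∘ IsMatroid.indep⊆ground isMsp I iI)
      (λ I iI → ⊆-reflexive groundPQ ∘ IsMatroid.indep⊆ground isMpq I iI)
      (λ x∈S x∈P∪Q → [ S#P x∈S , S#Q x∈S ] (x∈p∪q⁻ P Q x∈P∪Q))
      overlap⊆Z
    ρ[S∪Q∪Z]≡ : ρ (S ∪ (Q ∪ Z)) ≡ g + ρ Z
    ρ[S∪Q∪Z]≡ = trans (cong ρ (sym (∪-assoc S Q Z))) (sym (rankOf-contraction isU Msq-contracts (λ x∈ → x∈)))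

  connectivity : ℤ
  connectivity = + (rankOf Msq S + rankOf Msq Q) - + r Msq

  connectivity≤∣P∣ : connectivity ℤ.≤ + ∣ P ∣
  connectivity≤∣P∣ = m≤n+k⇒[+m]-[+n]≤+k rankOf-S+rankOf-Q≤r+∣P∣

  r∘S-r×S≡connectivity : + r (Msq ∘ᴹ S) - + r (Msq ×ᴹ S) ≡ connectivity
  r∘S-r×S≡connectivity = trans (r∘ᴹ-r×ᴹ isU Msq-contracts (p⊆p∪q Q))
    (cong (λ X → + (rankOf Msq S + rankOf Msq X) - + r Msq)
          (trans (cong (_─ S) (∪-comm S Q)) (p∪q─q≡p (λ x∈Q x∈S → S#Q x∈S x∈Q))))

  r∘Q-r×Q≡connectivity : + r (Msq ∘ᴹ Q) - + r (Msq ×ᴹ Q) ≡ connectivity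
  r∘Q-r×Q≡connectivity = trans (r∘ᴹ-r×ᴹ isU Msq-contracts (q⊆p∪q S Q))
    (cong (λ k → + k - + r Msq)
          (trans (cong (λ X → rankOf Msq Q + rankOf Msq X) (p∪q─q≡p S#Q)) (+-comm (rankOf Msq Q) (rankOf Msq S))))

open import Data.Nat using (ℕ)
open import Data.Integer using (ℤ; +_; _-_; _≤_)
open import Data.Product using (_×_; _,_)

corollary15 : (n : ℕ) (S P Q : Subset n) →
    S ∩ P ≡ ⊥ → P ∩ Q ≡ ⊥ → S ∩ Q ≡ ⊥ →
    (Msp Mpq : Matroid n) →
    ground (sys Msp) ≡ S ∪ P → ground (sys Mpq) ≡ P ∪ Q →
    let Msq = link S Q (sys Msp) (sys Mpq) in
    ((+ r (Msq ∘ᴹ S)) - (+ r (Msq ×ᴹ S)) ≤ + ∣ P ∣)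
    × ((+ r (Msq ∘ᴹ S)) - (+ r (Msq ×ᴹ S)) ≡ (+ r (Msq ∘ᴹ Q)) - (+ r (Msq ×ᴹ Q)))
corollary15 n S P Q S∩P≡⊥ P∩Q≡⊥ S∩Q≡⊥ Msp Mpq groundSP groundPQ =
  subst (_≤ + ∣ P ∣) (sym r∘S-r×S≡connectivity) connectivity≤∣P∣ ,
  trans r∘S-r×S≡connectivity (sym r∘Q-r×Q≡connectivity)
  where
  open Linking S P Q (∩≡⊥⇒Disjoint S∩P≡⊥) (∩≡⊥⇒Disjoint P∩Q≡⊥) (∩≡⊥⇒Disjoint S∩Q≡⊥)
               (isMatroid Msp) (isMatroid Mpq) groundSP groundPQ
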